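{- Let $P_n$ be the path on $n\geq 2$ vertices and $k\geq 1$. Then $$\gamma^r_k(P_n)=\begin{cases}1, & \text{if } k\geq n-1,\\ 2, & \text{if } \lfloor n/2\rfloor\leq k\leq n-2,\\ \left\lceil \frac{n}{2k+1}\right\rceil, & \text{if } 1\leq k\leq \lfloor n/2\rfloor -1.\end{cases}$$
   Context: $P_n$ has vertex set $\{1,\dots,n\}$ and edges $i(i+1)$ for $1\le i\le n-1$. For a graph $G=(V,E)$ and $k\geq 1$, a set $D\subseteq V$ is distance $k$-dominating if every $v\in V\setminus D$ is at distance at most $k$ from some vertex of $D$. An ordered set $W=\{w_1,\dots,w_r\}$ is a resolving set if for all distinct $u,v\in V\setminus W$ the distance vectors $(d_G(u,w_i))_i$ and $(d_G(v,w_i))_i$ differ. $\gamma^r_k(G)$ is the minimum cardinality of a set that is both resolving and distance $k$-dominating. -}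

module Defs where

open import Data.Nat using (ℕ; suc; _+_; _*_; _∸_; _≤_; ∣_-_∣)
open import Data.Nat.DivMod using (_/_)
open import Data.Fin using (Fin; toℕ)
open import Data.Fin.Subset using (Subset; _∈_; _∉_; ∣_∣)
open import Data.Product using (Σ; ∃; _×_; _,_)
open import Relation.Binary.PropositionalEquality using (_≡_; _≢_)

-- The path P_n: vertex i ∈ Fin n stands for the paper's vertex i+1,
-- edges join consecutive vertices. Its graph distance is |i - j|.
pathDist : {n : ℕ} → Fin n → Fin n → ℕ
pathDist i j = ∣ toℕ i - toℕ j ∣

IsDistKDominating : (n k : ℕ) → Subset n → Set
IsDistKDominating n k D =
  (v : Fin n) → v ∉ D → Σ (Fin n) λ d → d ∈ D × pathDist v d ≤ k

-- W is a resolving set of P_n (as in the paper: distinct vertices outside W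
-- have distinct distance vectors to W)
IsResolving : (n : ℕ) → Subset n → Set
IsResolving n W =
  (u v : Fin n) → u ∉ W → v ∉ W → u ≢ v →
  Σ (Fin n) λ w → w ∈ W × pathDist u w ≢ pathDist v w

IsResolvingDistKDominating : (n k : ℕ) → Subset n → Set
IsResolvingDistKDominating n k S = IsResolving n S × IsDistKDominating n k S

IsGammaRK : (n k m : ℕ) → Set
IsGammaRK n k m =
  (Σ (Subset n) λ S → IsResolvingDistKDominating n k S × ∣ S ∣ ≡ m)
  × ((S : Subset n) → IsResolvingDistKDominating n k S → m ≤ ∣ S ∣)

-- ⌈ n / (2k+1) ⌉
ceilDiv2k+1 : ℕ → ℕ → ℕ
ceilDiv2k+1 n k = (n + 2 * k) / suc (2 * k)

{-# OPTIONS --safe #-}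
-- A vertex of P_n dominates at most 2k+1 vertices, so every distance-k dominating set
-- has at least ⌈n/(2k+1)⌉ elements, and marking every (2k+1)-th vertex from vertex k on
-- (plus the last vertex when it is left uncovered) attains this bound.  Two distinct
-- landmarks a, b resolve P_n: two vertices equidistant from both would be mirror images
-- through a and through b.  If n ≥ 2k+2 the dominators of the two ends are distinct, so
-- the domination bound is the answer.  If k ≥ n-1 the endpoint alone works.  In between
-- a lone landmark would have to dominate both ends, hence be an interior vertex, and its
-- two neighbours would be unresolved.
module Submission where

open import Defs
open import Data.Nat using (ℕ; zero; suc; _+_; _*_; _∸_; _≤_; _<_; z≤n; s≤s; s≤s⁻¹; ∣_-_∣; _≤?_; ⌊_/2⌋)
open import Data.Nat.Properties
open import Data.Nat.DivMod using (_/_; m/n*n≤m; m*n/n≡m; /-monoˡ-≤)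
open import Data.Nat.Tactic.RingSolver using (solve-∀)
open import Data.Fin using (Fin; zero; suc; toℕ; fromℕ; fromℕ<; inject₁)
open import Data.Fin.Properties using (toℕ-injective; toℕ<n; toℕ-fromℕ; toℕ-fromℕ<; toℕ-inject₁)
open import Data.Fin.Subset using (Subset; inside; outside; _∈_; ∣_∣; ⁅_⁆)
open import Data.Fin.Subset.Properties using (_∈?_; x∈p⇒∣p-x∣<∣p∣; x∈p∧x≢y⇒x∈p-y; x∈⁅x⁆; ∣⁅x⁆∣≡1)
open import Data.Vec using ([]; _∷_; here; there)
open import Data.Product using (Σ; _×_; _,_; proj₁; proj₂)
open import Data.Sum using (_⊎_; inj₁; inj₂)
open import Function using (_∘_)
open import Relation.Nullary using (yes; no; contradiction)
open import Relation.Nullary.Decidable using (isYes)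
open import Relation.Binary.PropositionalEquality

private variable
  n k : ℕ
  S : Subset n
  u v w : Fin n

x∈p⇒0<∣p∣ : ∀ {x : Fin n} {p : Subset n} → x ∈ p → 0 < ∣ p ∣
x∈p⇒0<∣p∣ x∈p = ≤-trans (s≤s z≤n) (x∈p⇒∣p-x∣<∣p∣ x∈p)

x∈p⇒y∈p⇒x≢y⇒1<∣p∣ : ∀ {x y : Fin n} {p : Subset n} → x ∈ p → y ∈ p → x ≢ y → 1 < ∣ p ∣
x∈p⇒y∈p⇒x≢y⇒1<∣p∣ x∈p y∈p x≢y =
  ≤-trans (s≤s (x∈p⇒0<∣p∣ (x∈p∧x≢y⇒x∈p-y y∈p (x≢y ∘ sym)))) (x∈p⇒∣p-x∣<∣p∣ x∈p)

∣m-n∣≤o⇒m≤n+o : ∀ m n {o} → ∣ m - n ∣ ≤ o → m ≤ n + o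
∣m-n∣≤o⇒m≤n+o m n le = ≤-trans (m≤n+∣m-n∣ m n) (+-monoʳ-≤ n le)

∣m-n∣≤o⇒n≤m+o : ∀ m n {o} → ∣ m - n ∣ ≤ o → n ≤ m + o
∣m-n∣≤o⇒n≤m+o m n le = ∣m-n∣≤o⇒m≤n+o n m (subst (_≤ _) (∣-∣-comm m n) le)

m≤n+o⇒n≤m+o⇒∣m-n∣≤o : ∀ m n {o} → m ≤ n + o → n ≤ m + o → ∣ m - n ∣ ≤ o
m≤n+o⇒n≤m+o⇒∣m-n∣≤o zero    n       _  n≤o = n≤o
m≤n+o⇒n≤m+o⇒∣m-n∣≤o (suc m) zero    m≤o _   = m≤o
m≤n+o⇒n≤m+o⇒∣m-n∣≤o (suc m) (suc n) le₁ le₂ =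
  m≤n+o⇒n≤m+o⇒∣m-n∣≤o m n (s≤s⁻¹ le₁) (s≤s⁻¹ le₂)

reflection : ∀ {u a v} → u ≤ a → a ≤ v → a ∸ u ≡ v ∸ a → u + v ≡ a + a
reflection {u} {a} {v} u≤a a≤v eq = begin
  u + v               ≡⟨ cong (u +_) (sym (m∸n+n≡m a≤v)) ⟩
  u + ((v ∸ a) + a)   ≡⟨ cong (λ t → u + (t + a)) (sym eq) ⟩
  u + ((a ∸ u) + a)   ≡⟨ sym (+-assoc u (a ∸ u) a) ⟩
  (u + (a ∸ u)) + a   ≡⟨ cong (_+ a) (m+[n∸m]≡n u≤a) ⟩
  a + a               ∎
  where open ≡-Reasoning

equidistant⇒≡⊎reflection : ∀ u v a → ∣ u - a ∣ ≡ ∣ v - a ∣ → u ≡ v ⊎ u + v ≡ a + a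
equidistant⇒≡⊎reflection u v a eq with ≤-total u a | ≤-total v a
... | inj₁ u≤a | inj₁ v≤a = inj₁ (∸-cancelˡ-≡ u≤a v≤a
  (trans (sym (m≤n⇒∣m-n∣≡n∸m u≤a)) (trans eq (m≤n⇒∣m-n∣≡n∸m v≤a))))
... | inj₂ a≤u | inj₂ a≤v = inj₁ (∸-cancelʳ-≡ a≤u a≤v
  (trans (sym (m≤n⇒∣n-m∣≡n∸m a≤u)) (trans eq (m≤n⇒∣n-m∣≡n∸m a≤v))))
... | inj₁ u≤a | inj₂ a≤v = inj₂ (reflection u≤a a≤v
  (trans (sym (m≤n⇒∣m-n∣≡n∸m u≤a)) (trans eq (m≤n⇒∣n-m∣≡n∸m a≤v))))
... | inj₂ a≤u | inj₁ v≤a = inj₂ (trans (+-comm u v) (reflection v≤a a≤u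
  (trans (sym (m≤n⇒∣m-n∣≡n∸m v≤a)) (trans (sym eq) (m≤n⇒∣n-m∣≡n∸m a≤u)))))

-- Distinct u, v equidistant from a are mirror images through a, so a = (u + v)/2.
equidistant-from-two⇒≡ : ∀ {a b u v} → a ≢ b →
  ∣ u - a ∣ ≡ ∣ v - a ∣ → ∣ u - b ∣ ≡ ∣ v - b ∣ → u ≡ v
equidistant-from-two⇒≡ {a} {b} {u} {v} a≢b eqa eqb
  with equidistant⇒≡⊎reflection u v a eqa | equidistant⇒≡⊎reflection u v b eqb
... | inj₁ u≡v | _        = u≡v
... | inj₂ _   | inj₁ u≡v = u≡v
... | inj₂ u+v≡2a | inj₂ u+v≡2b = contradiction
  (trans (n≡⌊n+n/2⌋ a) (trans (cong ⌊_/2⌋ (trans (sym u+v≡2a) u+v≡2b)) (sym (n≡⌊n+n/2⌋ b))))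
  a≢b

pathDist-self : (v : Fin n) → pathDist v v ≡ 0
pathDist-self v = ∣n-n∣≡0 (toℕ v)

pathDist≡0⇒≡ : pathDist u v ≡ 0 → u ≡ v
pathDist≡0⇒≡ eq = toℕ-injective (∣m-n∣≡0⇒m≡n eq)

zero∈S⇒IsResolving : zero ∈ S → IsResolving (suc n) S
zero∈S⇒IsResolving 0∈S u v _ _ u≢v = zero , 0∈S , λ eq → u≢v (toℕ-injective
  (trans (sym (∣-∣-identityʳ (toℕ u))) (trans eq (∣-∣-identityʳ (toℕ v)))))

two-members⇒IsResolving : ∀ {a b : Fin n} → a ∈ S → b ∈ S → a ≢ b → IsResolving n S
two-members⇒IsResolving {a = a} {b} a∈S b∈S a≢b u v _ _ u≢v
  with pathDist u a ≟ pathDist v a | pathDist u b ≟ pathDist v b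
... | no ne | _     = a , a∈S , ne
... | yes _ | no ne = b , b∈S , ne
... | yes eqa | yes eqb = contradiction
  (toℕ-injective (equidistant-from-two⇒≡ (a≢b ∘ toℕ-injective) eqa eqb)) u≢v

equidistant⇒≢ : pathDist u w ≡ pathDist v w → u ≢ v → u ≢ w
equidistant⇒≢ {u = u} eq u≢v refl =
  u≢v (sym (pathDist≡0⇒≡ (trans (sym eq) (pathDist-self u))))

equidistant⇒1<∣S∣ : IsResolving n S → w ∈ S → u ≢ v → pathDist u w ≡ pathDist v w → 1 < ∣ S ∣
equidistant⇒1<∣S∣ {S = S} {u = u} {v} res w∈S u≢v eq with u ∈? S | v ∈? S
... | yes u∈S | _ = x∈p⇒y∈p⇒x≢y⇒1<∣p∣ u∈S w∈S (equidistant⇒≢ eq u≢v)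
... | _ | yes v∈S = x∈p⇒y∈p⇒x≢y⇒1<∣p∣ v∈S w∈S (equidistant⇒≢ (sym eq) (u≢v ∘ sym))
... | no u∉S | no v∉S with res u v u∉S v∉S u≢v
...   | w′ , w′∈S , ne = x∈p⇒y∈p⇒x≢y⇒1<∣p∣ w′∈S w∈S λ { refl → ne eq }

Dominates : ℕ → Subset n → Fin n → Set
Dominates {n} k S v = Σ (Fin n) λ d → d ∈ S × pathDist v d ≤ k

dominator : IsDistKDominating n k S → (v : Fin n) → Dominates k S v
dominator {S = S} dom v with v ∈? S
... | yes v∈S = v , v∈S , ≤-trans (≤-reflexive (pathDist-self v)) z≤n
... | no v∉S  = dom v v∉S

Dominates-∷ : ∀ {x} → Dominates k S v → Dominates k (x ∷ S) (suc v)
Dominates-∷ (d , d∈S , near) = suc d , there d∈S , near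

isGammaRK : ∀ {m} (S : Subset n) → IsResolvingDistKDominating n k S → ∣ S ∣ ≤ m →
  ((S′ : Subset n) → IsResolvingDistKDominating n k S′ → m ≤ ∣ S′ ∣) → IsGammaRK n k m
isGammaRK S rd ∣S∣≤m minimal = (S , rd , ≤-antisym ∣S∣≤m (minimal S rd)) , minimal

countBelow : Subset n → ℕ → ℕ
countBelow []            _       = 0
countBelow (_ ∷ _)       zero    = 0
countBelow (inside ∷ p)  (suc i) = suc (countBelow p i)
countBelow (outside ∷ p) (suc i) = countBelow p i

countBelow-mono : ∀ (p : Subset n) {i j} → i ≤ j → countBelow p i ≤ countBelow p j
countBelow-mono []            _         = z≤n
countBelow-mono (_ ∷ _)       z≤n       = z≤n
countBelow-mono (inside ∷ p)  (s≤s i≤j) = s≤s (countBelow-mono p i≤j)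
countBelow-mono (outside ∷ p) (s≤s i≤j) = countBelow-mono p i≤j

countBelow≤∣p∣ : ∀ (p : Subset n) i → countBelow p i ≤ ∣ p ∣
countBelow≤∣p∣ []            _       = z≤n
countBelow≤∣p∣ (_ ∷ _)       zero    = z≤n
countBelow≤∣p∣ (inside ∷ p)  (suc i) = s≤s (countBelow≤∣p∣ p i)
countBelow≤∣p∣ (outside ∷ p) (suc i) = countBelow≤∣p∣ p i

x∈p⇒countBelow-< : ∀ {x : Fin n} {p : Subset n} → x ∈ p →
  countBelow p (toℕ x) < countBelow p (suc (toℕ x))
x∈p⇒countBelow-< {p = inside ∷ _}  here        = s≤s z≤n
x∈p⇒countBelow-< {p = inside ∷ _}  (there x∈p) = s≤s (x∈p⇒countBelow-< x∈p)
x∈p⇒countBelow-< {p = outside ∷ _} (there x∈p) = x∈p⇒countBelow-< x∈p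

x∈p⇒a≤x<b⇒countBelow-< : ∀ {x : Fin n} {p : Subset n} {a b} →
  x ∈ p → a ≤ toℕ x → toℕ x < b → countBelow p a < countBelow p b
x∈p⇒a≤x<b⇒countBelow-< {p = p} x∈p a≤x x<b = ≤-trans
  (s≤s (countBelow-mono p a≤x))
  (≤-trans (x∈p⇒countBelow-< x∈p) (countBelow-mono p x<b))

-- The vertices q(2k+1), q = 0, 1, …, have pairwise disjoint k-neighbourhoods,
-- so each of them needs its own dominator.
module _ {S : Subset n} (dom : IsDistKDominating n k S) where

  private
    M : ℕ
    M = suc (2 * k)

    dominatorAt : ∀ i → i < n → Σ (Fin n) λ d → d ∈ S × ∣ i - toℕ d ∣ ≤ k
    dominatorAt i i<n with dominator dom (fromℕ< i<n)
    ... | d , d∈S , near = d , d∈S , subst (λ t → ∣ t - toℕ d ∣ ≤ k) (toℕ-fromℕ< i<n) near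

    next-block : ∀ q k → suc q * suc (2 * k) ≡ q * suc (2 * k) + suc k + k
    next-block = solve-∀

    blocks-dominated : ∀ q → q * M < n → suc q ≤ countBelow S (q * M + suc k)
    blocks-dominated zero 0<n with dominatorAt 0 0<n
    ... | d , d∈S , d≤k = ≤-trans (s≤s z≤n) (x∈p⇒a≤x<b⇒countBelow-< d∈S z≤n (s≤s d≤k))
    blocks-dominated (suc q) lt with dominatorAt (suc q * M) lt
    ... | d , d∈S , near = ≤-trans (s≤s (blocks-dominated q (≤-<-trans (m≤n+m (q * M) M) lt)))
                                    (x∈p⇒a≤x<b⇒countBelow-< d∈S after before)
      where
      after : q * M + suc k ≤ toℕ d
      after = +-cancelʳ-≤ k _ _
        (subst (_≤ toℕ d + k) (next-block q k) (∣m-n∣≤o⇒m≤n+o (suc q * M) (toℕ d) near))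
      before : toℕ d < suc q * M + suc k
      before = subst (toℕ d <_) (sym (+-suc (suc q * M) k))
        (s≤s (∣m-n∣≤o⇒n≤m+o (suc q * M) (toℕ d) near))

  dominating⇒ceilDiv2k+1≤∣S∣ : ceilDiv2k+1 n k ≤ ∣ S ∣
  dominating⇒ceilDiv2k+1≤∣S∣ with (n + 2 * k) / M | m/n*n≤m (n + 2 * k) M
  ... | zero  | _      = z≤n
  ... | suc q | c*M≤n+2k = ≤-trans (blocks-dominated q q*M<n) (countBelow≤∣p∣ S _)
    where
    q*M<n : q * M < n
    q*M<n = +-cancelʳ-≤ (2 * k) (suc (q * M)) n
      (subst (λ t → suc t ≤ n + 2 * k) (+-comm (2 * k) (q * M)) c*M≤n+2k)

-- centres n j marks vertex j and every (2k+1)-th vertex after it; the last vertex is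
-- marked as well when the mark before it lies more than k away (that is, when j ≤ k).
module Centres (k : ℕ) where

  centres : ∀ n → ℕ → Subset n
  centres zero          _       = []
  centres (suc zero)    j       = isYes (j ≤? k) ∷ []
  centres (suc (suc n)) zero    = inside ∷ centres (suc n) (2 * k)
  centres (suc (suc n)) (suc j) = outside ∷ centres (suc n) j

  first-centre : ∀ n j → j ≤ k → Σ (Fin (suc n)) λ d → d ∈ centres (suc n) j × toℕ d ≤ j
  first-centre zero j j≤k with j ≤? k
  ... | yes _   = zero , here , z≤n
  ... | no j≰k  = contradiction j≤k j≰k
  first-centre (suc n) zero    _   = zero , here , z≤n
  first-centre (suc n) (suc j) j<k with first-centre n j (<⇒≤ j<k)
  ... | d , d∈C , d≤j = suc d , there d∈C , s≤s d≤j

  -- In a longer marking whose tail is centres n j, the previous mark sits at position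
  -- j - (2k+1) relative to the tail, and p + k < j says exactly that it dominates p.
  dominated⊎before : ∀ n j (p : Fin n) → toℕ p + k < j ⊎ Dominates k (centres n j) p
  dominated⊎before (suc zero) j zero with j ≤? k
  ... | yes _   = inj₂ (zero , here , z≤n)
  ... | no j≰k  = inj₁ (≰⇒> j≰k)
  dominated⊎before (suc (suc n)) zero zero = inj₂ (zero , here , z≤n)
  dominated⊎before (suc (suc n)) zero (suc p) with dominated⊎before (suc n) (2 * k) p
  ... | inj₂ dominated = inj₂ (Dominates-∷ dominated)
  ... | inj₁ p+k<2k    = inj₂ (zero , here , +-cancelʳ-≤ k (suc (toℕ p)) k
                           (subst (suc (toℕ p + k) ≤_) (cong (k +_) (+-identityʳ k)) p+k<2k))
  dominated⊎before (suc (suc n)) (suc j) zero with suc j ≤? k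
  ... | no j≰k = inj₁ (≰⇒> j≰k)
  ... | yes j<k with first-centre n j (<⇒≤ j<k)
  ...   | d , d∈C , d≤j = inj₂ (suc d , there d∈C , ≤-trans (s≤s d≤j) j<k)
  dominated⊎before (suc (suc n)) (suc j) (suc p) with dominated⊎before (suc n) j p
  ... | inj₁ p+k<j     = inj₁ (s≤s p+k<j)
  ... | inj₂ dominated = inj₂ (Dominates-∷ dominated)

  centres-dominating : ∀ n → IsDistKDominating n k (centres n k)
  centres-dominating n p _ with dominated⊎before n k p
  ... | inj₁ p+k<k     = contradiction p+k<k (m+n≮n (toℕ p) k)
  ... | inj₂ dominated = dominated

  -- The extra k pays for a marked last vertex, which lies more than k after the
  -- previous mark.
  ∣centres∣-bound : ∀ n j → j ≤ 2 * k → ∣ centres n j ∣ * suc (2 * k) + j ≤ n + (k + 2 * k)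
  ∣centres∣-bound zero j j≤2k = ≤-trans j≤2k (m≤n+m (2 * k) k)
  ∣centres∣-bound (suc zero) j j≤2k with j ≤? k
  ... | yes j≤k = ≤-trans (+-monoʳ-≤ (1 * suc (2 * k)) j≤k) (≤-reflexive (one-centre k))
    where
    one-centre : ∀ k → 1 * suc (2 * k) + k ≡ 1 + (k + 2 * k)
    one-centre = solve-∀
  ... | no _ = ≤-trans j≤2k (≤-trans (m≤n+m (2 * k) k) (n≤1+n _))
  ∣centres∣-bound (suc (suc n)) zero _ =
    subst₂ _≤_ (new-centre ∣ centres (suc n) (2 * k) ∣ k) (new-vertex n k)
      (+-monoˡ-≤ 1 (∣centres∣-bound (suc n) (2 * k) ≤-refl))
    where
    new-centre : ∀ c k → (c * suc (2 * k) + 2 * k) + 1 ≡ suc c * suc (2 * k) + 0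
    new-centre = solve-∀
    new-vertex : ∀ n k → (suc n + (k + 2 * k)) + 1 ≡ suc (suc n) + (k + 2 * k)
    new-vertex = solve-∀
  ∣centres∣-bound (suc (suc n)) (suc j) j<2k =
    subst (_≤ suc (suc n) + (k + 2 * k)) (sym (+-suc (∣ centres (suc n) j ∣ * suc (2 * k)) j))
      (s≤s (∣centres∣-bound (suc n) j (<⇒≤ j<2k)))

  ∣centres∣≤ceilDiv2k+1 : ∀ n → ∣ centres n k ∣ ≤ ceilDiv2k+1 n k
  ∣centres∣≤ceilDiv2k+1 n = begin
    ∣ centres n k ∣           ≡⟨ sym (m*n/n≡m ∣ centres n k ∣ M) ⟩
    ∣ centres n k ∣ * M / M   ≤⟨ /-monoˡ-≤ M ∣centres∣*M≤n+2k ⟩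
    (n + 2 * k) / M           ∎
    where
    open ≤-Reasoning
    M = suc (2 * k)
    rearrange : ∀ n k → n + (k + 2 * k) ≡ n + 2 * k + k
    rearrange = solve-∀
    ∣centres∣*M≤n+2k : ∣ centres n k ∣ * M ≤ n + 2 * k
    ∣centres∣*M≤n+2k = +-cancelʳ-≤ k _ _
      (subst (∣ centres n k ∣ * M + k ≤_) (rearrange n k) (∣centres∣-bound n k (m≤m+n k _)))

long-path-dominating⇒IsResolving : suc k + suc k ≤ n → IsDistKDominating n k S → IsResolving n S
long-path-dominating⇒IsResolving {k = k} {n = suc m} 2k+2≤n dom
  with dominator dom zero | dominator dom (fromℕ m)
... | d₀ , d₀∈S , d₀≤k | d₁ , d₁∈S , near = two-members⇒IsResolving d₀∈S d₁∈S d₀≢d₁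
  where
  d₀≢d₁ : d₀ ≢ d₁
  d₀≢d₁ refl = <⇒≱ (subst (_≤ m) (+-suc k k) (s≤s⁻¹ 2k+2≤n)) (begin
    m            ≡⟨ toℕ-fromℕ m ⟨
    toℕ (fromℕ m) ≤⟨ ∣m-n∣≤o⇒m≤n+o (toℕ (fromℕ m)) (toℕ d₀) near ⟩
    toℕ d₀ + k   ≤⟨ +-monoˡ-≤ k d₀≤k ⟩
    k + k        ∎)
    where open ≤-Reasoning

interior-member⇒1<∣S∣ : ∀ {m} {S : Subset (suc (suc m))} {t : Fin (suc m)} →
  IsResolving (suc (suc m)) S → suc t ∈ S → toℕ t < m → 1 < ∣ S ∣
interior-member⇒1<∣S∣ {t = t} res t+1∈S t<m =
  equidistant⇒1<∣S∣ res t+1∈S previous≢next equidistant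
  where
  previous next : Fin _
  previous = inject₁ t
  next     = fromℕ< (s≤s (s≤s t<m))
  previous≢next : previous ≢ next
  previous≢next eq = <⇒≢ (m<n⇒m<1+n (n<1+n (toℕ t)))
    (trans (sym (toℕ-inject₁ t)) (trans (cong toℕ eq) (toℕ-fromℕ< (s≤s (s≤s t<m)))))
  equidistant : pathDist previous (suc t) ≡ pathDist next (suc t)
  equidistant = begin
    ∣ toℕ (inject₁ t) - suc (toℕ t) ∣       ≡⟨ cong ∣_- suc (toℕ t) ∣ (toℕ-inject₁ t) ⟩
    ∣ toℕ t - suc (toℕ t) ∣                 ≡⟨ ∣-∣-comm (toℕ t) (suc (toℕ t)) ⟩
    ∣ suc (suc (toℕ t)) - suc (toℕ t) ∣     ≡⟨ cong ∣_- suc (toℕ t) ∣ (toℕ-fromℕ< (s≤s (s≤s t<m))) ⟨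
    ∣ toℕ next - suc (toℕ t) ∣             ∎
    where open ≡-Reasoning

γ≡1 : ∀ m k → m ≤ k → IsGammaRK (suc m) k 1
γ≡1 m k m≤k = isGammaRK ⁅ zero ⁆ (zero∈S⇒IsResolving (x∈⁅x⁆ zero) , dominating)
  (≤-reflexive (∣⁅x⁆∣≡1 (zero {m}))) λ _ (_ , dom) → x∈p⇒0<∣p∣ (proj₁ (proj₂ (dominator dom zero)))
  where
  dominating : IsDistKDominating (suc m) k ⁅ zero ⁆
  dominating v _ = zero , x∈⁅x⁆ zero ,
    subst (_≤ k) (sym (∣-∣-identityʳ (toℕ v))) (≤-trans (s≤s⁻¹ (toℕ<n v)) m≤k)

resolving-dominating⇒1<∣S∣ : ∀ {k} m {S : Subset (suc (suc m))} → k ≤ m →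
  IsResolvingDistKDominating (suc (suc m)) k S → 1 < ∣ S ∣
resolving-dominating⇒1<∣S∣ {k} m k≤m (res , dom) with dominator dom zero
... | suc t , t+1∈S , t+1≤k = interior-member⇒1<∣S∣ res t+1∈S (≤-trans t+1≤k k≤m)
... | zero , 0∈S , _ with dominator dom (fromℕ (suc m))
...   | zero  , _   , m+1≤k = contradiction k≤m (<⇒≱ (subst (_≤ k) (cong suc (toℕ-fromℕ m)) m+1≤k))
...   | suc d , d∈S , _     = x∈p⇒y∈p⇒x≢y⇒1<∣p∣ 0∈S d∈S λ ()

γ≡2 : ∀ m k → m < k + k → k ≤ m → IsGammaRK (suc (suc m)) k 2
γ≡2 m k m<2k k≤m = isGammaRK endpoints
  (two-members⇒IsResolving here last∈endpoints (λ ()) , dominating)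
  (≤-reflexive (cong suc (∣⁅x⁆∣≡1 (fromℕ m)))) λ _ → resolving-dominating⇒1<∣S∣ m k≤m
  where
  endpoints : Subset (suc (suc m))
  endpoints = inside ∷ ⁅ fromℕ m ⁆
  last∈endpoints : fromℕ (suc m) ∈ endpoints
  last∈endpoints = there (x∈⁅x⁆ (fromℕ m))
  dominating : IsDistKDominating (suc (suc m)) k endpoints
  dominating v _ with toℕ v ≤? k
  ... | yes v≤k = zero , here , subst (_≤ k) (sym (∣-∣-identityʳ (toℕ v))) v≤k
  ... | no v≰k  = fromℕ (suc m) , last∈endpoints ,
    subst (λ x → ∣ toℕ v - x ∣ ≤ k) (sym (toℕ-fromℕ (suc m)))
      (m≤n+o⇒n≤m+o⇒∣m-n∣≤o (toℕ v) (suc m)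
        (≤-trans (s≤s⁻¹ (toℕ<n v)) (m≤m+n (suc m) k))
        (≤-trans m<2k (+-monoˡ-≤ k (<⇒≤ (≰⇒> v≰k)))))

γ≡ceilDiv2k+1 : ∀ n k → suc k + suc k ≤ n → IsGammaRK n k (ceilDiv2k+1 n k)
γ≡ceilDiv2k+1 n k 2k+2≤n = isGammaRK (centres n k)
  (long-path-dominating⇒IsResolving 2k+2≤n (centres-dominating n) , centres-dominating n)
  (∣centres∣≤ceilDiv2k+1 n) λ _ (_ , dom) → dominating⇒ceilDiv2k+1≤∣S∣ dom
  where open Centres k

⌊n/2⌋+⌊n/2⌋≤n : ∀ n → ⌊ n /2⌋ + ⌊ n /2⌋ ≤ n
⌊n/2⌋+⌊n/2⌋≤n n = ≤-trans (+-monoʳ-≤ ⌊ n /2⌋ (⌊n/2⌋≤⌈n/2⌉ n)) (≤-reflexive (⌊n/2⌋+⌈n/2⌉≡n n))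

n≤1+⌊n/2⌋+⌊n/2⌋ : ∀ n → n ≤ suc (⌊ n /2⌋ + ⌊ n /2⌋)
n≤1+⌊n/2⌋+⌊n/2⌋ n = begin
  n                           ≡⟨ ⌊n/2⌋+⌈n/2⌉≡n n ⟨
  ⌊ n /2⌋ + ⌊ suc n /2⌋       ≤⟨ +-monoʳ-≤ ⌊ n /2⌋ (⌊n/2⌋-mono (n≤1+n (suc n))) ⟩
  ⌊ n /2⌋ + suc ⌊ n /2⌋       ≡⟨ +-suc ⌊ n /2⌋ ⌊ n /2⌋ ⟩
  suc (⌊ n /2⌋ + ⌊ n /2⌋)     ∎
  where open ≤-Reasoning

proposition2p2 : (n k : ℕ) → 2 ≤ n → 1 ≤ k →
    ((n ∸ 1 ≤ k) → IsGammaRK n k 1)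
    × ((⌊ n /2⌋ ≤ k × k ≤ n ∸ 2) → IsGammaRK n k 2)
    × ((k ≤ ⌊ n /2⌋ ∸ 1) → IsGammaRK n k (ceilDiv2k+1 n k))
proposition2p2 (suc zero)    _ (s≤s ()) _
proposition2p2 (suc (suc m)) k _ _ =
    γ≡1 (suc m) k
  , (λ (⌊n/2⌋≤k , k≤m) → γ≡2 m k
      (s≤s⁻¹ (≤-trans (n≤1+⌊n/2⌋+⌊n/2⌋ (suc (suc m))) (s≤s (+-mono-≤ ⌊n/2⌋≤k ⌊n/2⌋≤k)))) k≤m)
  , λ k<⌊n/2⌋ → γ≡ceilDiv2k+1 (suc (suc m)) k
      (≤-trans (+-mono-≤ (s≤s k<⌊n/2⌋) (s≤s k<⌊n/2⌋)) (⌊n/2⌋+⌊n/2⌋≤n (suc (suc m))))
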